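{- Let $\Psi\subset\Delta^+_\ell$ be a root ideal, $M$ a multiset on $[\ell]$, and $i\in[\ell-1]$ such that $s_i\Psi=\Psi$ and $m_M(i+1)=m_M(i)+1$. Then for every $\gamma\in\mathbb Z^\ell$, $K(\Psi;M;\gamma)+K(\Psi;M;s_i\gamma-\epsilon_i+\epsilon_{i+1})=0$.
   Context: $h_d$ complete homogeneous symmetric functions ($h_0=1$, $h_d=0$ for $d<0$); $k^{(r)}_m=\sum_{i=0}^m\binom{r+i-1}{i}h_{m-i}$; $g_\gamma=\det(k^{(i-1)}_{\gamma_i+j-i})_{1\le i,j\le\ell}$ for $\gamma\in\mathbb Z^\ell$. $\Delta^+_\ell=\{(i,j):1\le i<j\le\ell\}$; a root ideal is an upper order ideal for $(a,b)\le(c,d)\iff a\ge c,b\le d$. A multiset on $[\ell]$ has support in $[\ell]$, with multiplicity function $m_M$. $K(\Psi;M;\gamma)=g\big(\prod_{(a,b)\in\Psi}(1-z_a/z_b)^{ -1}\prod_{b\in M}(1-1/z_b)\mathbf z^\gamma\big)$, expanded in $\mathbb Z[[z_1/z_2,\dots,z_{\ell-1}/z_\ell]][z_1^{\pm1},\dots,z_\ell^{\pm1}]$, with $g:\mathbf z^\gamma\mapsto g_\gamma$ additive. $s_i\Psi=\{(s_i(a),s_i(b)):(a,b)\in\Psi\}$ with $s_i$ the transposition $(i,i+1)$; $s_i\gamma$ swaps entries $i,i+1$; $\epsilon_i$ unit vectors. -}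

module Defs where

open import Level using (Level)
open import Algebra.Bundles using (CommutativeRing)
open import Data.Nat as ℕ using (ℕ; zero; suc; _∸_)
open import Data.Nat.Combinatorics using (_C_)
open import Data.Integer as ℤ using (ℤ; +_; -[1+_])
open import Data.Fin as Fin using (Fin; zero; suc; toℕ; inject₁; _≟_)
open import Data.Bool using (Bool; true; false; if_then_else_)
open import Data.List using (List; []; _∷_; _++_; map; concatMap; replicate; allFin; filterᵇ)
open import Data.Product using (_×_; _,_)
open import Relation.Nullary using (does)
open import Relation.Binary.PropositionalEquality using (_≡_)

-- Combinatorial data (indices are 0-based: [ℓ] is rendered as Fin ℓ)

Pairs : ℕ → Set
Pairs ℓ = Fin ℓ → Fin ℓ → Bool

IsRootIdeal : ∀ {ℓ} → Pairs ℓ → Set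
IsRootIdeal {ℓ} Ψ =
  (∀ a b → Ψ a b ≡ true → a Fin.< b) ×
  (∀ a b c d → Ψ a b ≡ true → c Fin.≤ a → b Fin.≤ d → Ψ c d ≡ true)

Multiset : ℕ → Set
Multiset ℓ = Fin ℓ → ℕ

-- The simple transposition s_i = (i, i+1) on [ℓ], ℓ = suc n, i ∈ [ℓ-1]
-- (0-based: swaps inject₁ i and suc i).
swapᵢ : ∀ {n} → Fin n → Fin (suc n) → Fin (suc n)
swapᵢ i x =
  if does (x ≟ inject₁ i) then suc i
  else (if does (x ≟ suc i) then inject₁ i else x)

-- s_i Ψ = {(s_i a, s_i b) : (a,b) ∈ Ψ}; since s_i is an involution its
-- characteristic function is (c,d) ↦ Ψ (s_i c) (s_i d).
sΨ : ∀ {n} → Fin n → Pairs (suc n) → Pairs (suc n)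
sΨ i Ψ c d = Ψ (swapᵢ i c) (swapᵢ i d)

ε : ∀ {ℓ} → Fin ℓ → Fin ℓ → ℤ
ε a x = if does (x ≟ a) then + 1 else + 0

sγ : ∀ {n} → Fin n → (Fin (suc n) → ℤ) → (Fin (suc n) → ℤ)
sγ i γ x = (γ (swapᵢ i x) ℤ.- ε (inject₁ i) x) ℤ.+ ε (suc i) x

-- Ring-valued part: a commutative ring R and a sequence h with h 0 = 1
-- standing for the complete homogeneous symmetric functions.

module _ {c r : Level} (R : CommutativeRing c r) where
  open CommutativeRing R using (Carrier; _+_; _*_; -_; _-_; 0#; 1#)

  fromℕ : ℕ → Carrier
  fromℕ zero    = 0#
  fromℕ (suc n) = 1# + fromℕ n

  sumTo : ℕ → (ℕ → Carrier) → Carrier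
  sumTo zero    f = f 0
  sumTo (suc N) f = sumTo N f + f (suc N)

  sumFin : ∀ n → (Fin n → Carrier) → Carrier
  sumFin zero    f = 0#
  sumFin (suc n) f = f zero + sumFin n (λ j → f (suc j))

  det : ∀ n → (Fin n → Fin n → Carrier) → Carrier
  det zero    A = 1#
  det (suc n) A = sumFin (suc n) λ j →
    sign j * (A zero j * det n (λ a b → A (suc a) (Fin.punchIn j b)))
    where
      sign : Fin (suc n) → Carrier
      sign j with toℕ j ℕ.% 2
      ... | zero = 1#
      ... | suc _ = - 1#

  module _ (h : ℕ → Carrier) where

    hℤ : ℤ → Carrier
    hℤ (+ d)     = h d
    hℤ -[1+ _ ]  = 0#

    -- k^{(r)}_m = Σ_{i=0}^m binom(r+i-1, i) h_{m-i}   (= 0 for m < 0)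
    -- (binom(-1,0) = 1 is realised by (0 ∸ 1) C 0 = 0 C 0 = 1)
    kk : ℕ → ℤ → Carrier
    kk ρ (+ m)     = sumTo m (λ i → fromℕ ((ρ ℕ.+ i ∸ 1) C i) * h (m ∸ i))
    kk ρ -[1+ _ ]  = 0#

    -- g_γ = det ( k^{(i-1)}_{γ_i + j - i} )  (0-based i, j)
    g : ∀ ℓ → (Fin ℓ → ℤ) → Carrier
    g ℓ γ = det ℓ (λ i j → kk (toℕ i) ((γ i ℤ.+ + toℕ j) ℤ.- + toℕ i))

    -- Factors of the series  Π_{(a,b)∈Ψ} (1 - z_a/z_b)^{-1} Π_{b∈M} (1 - 1/z_b).
    data Factor (ℓ : ℕ) : Set where
      root : Fin ℓ → Fin ℓ → Factor ℓ   -- (1 - z_a/z_b)^{-1} = Σ_n (z_a/z_b)^n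
      down : Fin ℓ → Factor ℓ           -- (1 - 1/z_b)

    -- Apply g termwise to (product of factors) · z^γ, where each geometric
    -- series is truncated at exponent N.
    G : ∀ {ℓ} → ℕ → List (Factor ℓ) → (Fin ℓ → ℤ) → Carrier
    G {ℓ} N []              γ = g ℓ γ
    G     N (root a b ∷ fs) γ = sumTo N λ k →
      G N fs (λ x → (γ x ℤ.+ (+ k ℤ.* ε a x)) ℤ.- (+ k ℤ.* ε b x))
    G     N (down b ∷ fs)   γ = G N fs γ - G N fs (λ x → γ x ℤ.- ε b x)

    factors : ∀ {ℓ} → Pairs ℓ → Multiset ℓ → List (Factor ℓ)
    factors {ℓ} Ψ M =
      map (λ { (a , b) → root a b })
          (filterᵇ (λ { (a , b) → Ψ a b })
                   (concatMap (λ a → map (λ b → (a , b)) (allFin ℓ)) (allFin ℓ)))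
      ++ concatMap (λ b → replicate (M b) (down b)) (allFin ℓ)

    Kₜ : ∀ {ℓ} → ℕ → Pairs ℓ → Multiset ℓ → (Fin ℓ → ℤ) → Carrier
    Kₜ N Ψ M γ = G N (factors Ψ M) γ

{-# OPTIONS --safe #-}
-- The factor (1 − 1/z_{i+1}) turns g into g′(γ) = g_γ − g_{γ−ε_{i+1}}. Since
-- k^{(i+1)}_m − k^{(i+1)}_{m−1} = k^{(i)}_m, g′(γ) is the determinant of the matrix of g_γ with
-- row i+1 lowered to level i; rows i and i+1 then have the same level, and γ ↦ s_iγ − ε_i + ε_{i+1}
-- merely interchanges them, so g′ changes sign. The remaining factors (those of Ψ and of M minus
-- one copy of i+1) commute, and conjugating one of them by this affine map applies s_i to its
-- indices; as they form an s_i-invariant multiset, K(Ψ;M;·) inherits the antisymmetry of g′.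
module Submission where

open import Defs
open import Level using (Level)
open import Algebra.Bundles using (CommutativeRing)
open import Data.Bool using (Bool; true; false; if_then_else_)
open import Data.Fin as Fin using (Fin; zero; suc; toℕ; inject₁; punchIn; _≟_)
open import Data.Fin.Properties using (toℕ-inject₁; toℕ-fromℕ; suc-injective; <⇒≢; ≤̄⇒inject₁<; ≤-refl)
open import Data.Integer as ℤ using (ℤ; +_; -[1+_])
import Data.Integer.Properties as ℤ
import Data.Integer.Tactic.RingSolver as ℤ-Solver
open import Data.List using (List; []; _∷_; _++_; [_]; foldr; map; concatMap; replicate; filterᵇ; allFin)
open import Data.List.Properties using (map-++; map-∘; map-tabulate; map-cong; foldr-++)
open import Data.List.Membership.Propositional using (_∈_)
open import Data.List.Membership.Propositional.Properties using (∈-∃++)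
open import Data.List.Relation.Unary.Any using (here; there)
open import Data.List.Relation.Binary.Permutation.Propositional as ↭ using (_↭_; ↭-refl; ↭-trans; ↭-prep; ↭-sym)
open import Data.List.Relation.Binary.Permutation.Propositional.Properties using (shift)
open import Data.Maybe using (nothing)
open import Data.Nat as ℕ using (ℕ; zero; suc; _∸_; _≤_)
import Data.Nat.Properties as ℕ
import Data.Nat.ListAction as ℕ
import Data.Nat.ListAction.Properties as ℕ
open import Data.Product using (Σ; ∃; _×_; _,_; proj₁; proj₂)
open import Function using (_∘_; _∘′_; mk⇔)
open import Relation.Binary.Definitions using (DecidableEquality)
open import Relation.Binary.PropositionalEquality as ≡ using (_≡_; _≢_)
open import Relation.Nullary using (does; yes; no)
open import Relation.Nullary.Decidable using (dec-true; dec-false; does-⇔)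
open import Relation.Nullary.Negation using (contradiction)
open import Tactic.RingSolver.Core.AlmostCommutativeRing using (fromCommutativeRing)

Extensional : ∀ {c r} (R : CommutativeRing c r) {A B : Set} → ((A → B) → CommutativeRing.Carrier R) → Set r
Extensional R Φ = ∀ {f g} → (∀ x → f x ≡ g x) → CommutativeRing._≈_ R (Φ f) (Φ g)

module Sums {c r : Level} (R : CommutativeRing c r) where
  open CommutativeRing R hiding (zero)
  open import Algebra.Properties.Semiring.Sum semiring public
  open import Algebra.Properties.AbelianGroup +-abelianGroup using (⁻¹-∙-comm; ε⁻¹≈ε)

  sumFin≡sum : ∀ n (f : Fin n → Carrier) → sumFin R n f ≡ sum f
  sumFin≡sum zero    f = ≡.refl
  sumFin≡sum (suc n) f = ≡.cong (_+_ (f zero)) (sumFin≡sum n (f ∘ suc))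

  sumTo≈sum : ∀ N (f : ℕ → Carrier) → sumTo R N f ≈ ∑[ k < suc N ] f (toℕ k)
  sumTo≈sum zero    f = sym (+-identityʳ (f 0))
  sumTo≈sum (suc N) f = begin
    sumTo R N f + f (suc N)
      ≈⟨ +-congʳ (sumTo≈sum N f) ⟩
    ∑[ k < suc N ] f (toℕ k) + f (suc N)
      ≡⟨ ≡.cong₂ _+_ (sum-cong-≗ {suc N} (≡.cong f ∘ ≡.sym ∘ toℕ-inject₁)) (≡.cong f (≡.sym (toℕ-fromℕ (suc N)))) ⟩
    ∑[ k < suc N ] f (toℕ (inject₁ k)) + f (toℕ (Fin.fromℕ (suc N)))
      ≈⟨ sum-init-last (f ∘ toℕ) ⟨
    ∑[ k < suc (suc N) ] f (toℕ k)  ∎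
    where open import Relation.Binary.Reasoning.Setoid setoid

  sum-neg : ∀ {n} (f : Fin n → Carrier) → ∑[ j < n ] (- f j) ≈ - sum f
  sum-neg {zero}  f = sym ε⁻¹≈ε
  sum-neg {suc n} f = trans (+-congˡ (sum-neg (f ∘ suc))) (⁻¹-∙-comm (f zero) (sum (f ∘ suc)))

  sum-distrib-- : ∀ {n} (f g : Fin n → Carrier) → ∑[ j < n ] (f j - g j) ≈ sum f - sum g
  sum-distrib-- f g = trans (∑-distrib-+ f (λ j → - g j)) (+-congˡ (sum-neg g))

module Determinant {c r : Level} (R : CommutativeRing c r) where
  open CommutativeRing R hiding (zero)
  open Sums R
  open import Algebra.Properties.Ring ring using (-‿distribˡ-*; -‿distribʳ-*; x[y-z]≈xy-xz; [y-z]x≈yx-zx)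
  open import Algebra.Properties.Group +-group using (⁻¹-involutive; inverseʳ-unique)
  open import Algebra.Properties.AbelianGroup +-abelianGroup using (⁻¹-anti-homo‿-)
  open import Tactic.RingSolver.NonReflective (fromCommutativeRing R (λ _ → nothing))
  open import Relation.Binary.Reasoning.Setoid setoid

  Matrix : ℕ → Set c
  Matrix n = Fin n → Fin n → Carrier

  minor : ∀ {n} → Matrix (suc n) → Fin (suc n) → Matrix n
  minor A j a b = A (suc a) (punchIn j b)

  sgn : ℕ → Carrier
  sgn zero    = 1#
  sgn (suc k) = - sgn k

  laplaceTerm : ∀ {n} → Matrix (suc n) → Fin (suc n) → Carrier
  laplaceTerm {n} A j = A zero j * det R n (minor A j)

  -- The sign in det is a local function of (toℕ j % 2), which cannot be
  -- named; exposing it as a Σ-witness lets a with-abstraction reach it.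
  private
    det-unfold : ∀ n (A : Matrix (suc n)) → Σ (Fin n → Carrier) λ sign →
      det R (suc n) A ≡ 1# * laplaceTerm A zero + sumFin R n (λ j → sign j * laplaceTerm A (suc j))
    det-unfold n A = _ , ≡.refl

    parity : ℕ → Carrier
    parity zero    = 1#
    parity (suc _) = - 1#

    det-sign≡parity : ∀ n A j → proj₁ (det-unfold n A) j ≡ parity (suc (toℕ j) ℕ.% 2)
    det-sign≡parity n A j with suc (toℕ j) ℕ.% 2
    ... | zero  = ≡.refl
    ... | suc _ = ≡.refl

    parity≈sgn : ∀ k → parity (k ℕ.% 2) ≈ sgn k
    parity≈sgn zero          = refl
    parity≈sgn (suc zero)    = refl
    parity≈sgn (suc (suc k)) = trans (parity≈sgn k) (sym (⁻¹-involutive (sgn k)))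

  alternatingSum : ∀ {n} → (Fin n → Carrier) → Carrier
  alternatingSum {n} t = ∑[ j < n ] (sgn (toℕ j) * t j)

  alternatingSum-cong : ∀ {n} {s t : Fin n → Carrier} → (∀ j → s j ≈ t j) → alternatingSum s ≈ alternatingSum t
  alternatingSum-cong {n} s≈t = sum-cong-≋ {n} (λ j → *-congˡ (s≈t j))

  alternatingSum-distrib-- : ∀ {n} (s t : Fin n → Carrier) →
    alternatingSum (λ j → s j - t j) ≈ alternatingSum s - alternatingSum t
  alternatingSum-distrib-- {n} s t = trans (sum-cong-≋ {n} (λ j → x[y-z]≈xy-xz (sgn (toℕ j)) (s j) (t j)))
                                           (sum-distrib-- (λ j → sgn (toℕ j) * s j) (λ j → sgn (toℕ j) * t j))

  alternatingSum-neg : ∀ {n} (t : Fin n → Carrier) → alternatingSum (λ j → - t j) ≈ - alternatingSum t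
  alternatingSum-neg {n} t = trans (sum-cong-≋ {n} (λ j → sym (-‿distribʳ-* (sgn (toℕ j)) (t j))))
                                   (sum-neg (λ j → sgn (toℕ j) * t j))

  det-expand : ∀ n (A : Matrix (suc n)) → det R (suc n) A ≈ alternatingSum (laplaceTerm A)
  det-expand n A = begin
    det R (suc n) A
      ≡⟨ proj₂ (det-unfold n A) ⟩
    1# * laplaceTerm A zero + sumFin R n (λ j → sign j * laplaceTerm A (suc j))
      ≡⟨ ≡.cong (_+_ (1# * laplaceTerm A zero)) (sumFin≡sum n _) ⟩
    1# * laplaceTerm A zero + ∑[ j < n ] (sign j * laplaceTerm A (suc j))
      ≈⟨ +-congˡ (sum-cong-≋ {n} λ j → *-congʳ (sign≈sgn j)) ⟩
    alternatingSum (laplaceTerm A)  ∎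
    where
    sign : Fin n → Carrier
    sign = proj₁ (det-unfold n A)
    sign≈sgn : ∀ j → sign j ≈ sgn (suc (toℕ j))
    sign≈sgn j = trans (reflexive (det-sign≡parity n A j)) (parity≈sgn (suc (toℕ j)))

  det-via-laplaceTerms : ∀ {n} (A B C : Matrix (suc n)) →
    (∀ j → laplaceTerm C j ≈ laplaceTerm A j - laplaceTerm B j) → det R (suc n) C ≈ det R (suc n) A - det R (suc n) B
  det-via-laplaceTerms {n} A B C terms = begin
    det R (suc n) C                                                  ≈⟨ det-expand n C ⟩
    alternatingSum (laplaceTerm C)                                   ≈⟨ alternatingSum-cong terms ⟩
    alternatingSum (λ j → laplaceTerm A j - laplaceTerm B j)         ≈⟨ alternatingSum-distrib-- (laplaceTerm A) (laplaceTerm B) ⟩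
    alternatingSum (laplaceTerm A) - alternatingSum (laplaceTerm B)  ≈⟨ +-cong (det-expand n A) (-‿cong (det-expand n B)) ⟨
    det R (suc n) A - det R (suc n) B                                ∎

  det-neg-via-laplaceTerms : ∀ {n} (B C : Matrix (suc n)) →
    (∀ j → laplaceTerm C j ≈ - laplaceTerm B j) → det R (suc n) C ≈ - det R (suc n) B
  det-neg-via-laplaceTerms {n} B C terms = begin
    det R (suc n) C                           ≈⟨ det-expand n C ⟩
    alternatingSum (laplaceTerm C)            ≈⟨ alternatingSum-cong terms ⟩
    alternatingSum (λ j → - laplaceTerm B j)  ≈⟨ alternatingSum-neg (laplaceTerm B) ⟩
    - alternatingSum (laplaceTerm B)          ≈⟨ -‿cong (det-expand n B) ⟨
    - det R (suc n) B                         ∎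

  det-cong : ∀ n {A B : Matrix n} → (∀ x y → A x y ≈ B x y) → det R n A ≈ det R n B
  det-cong zero    A≈B = refl
  det-cong (suc n) {A} {B} A≈B = begin
    det R (suc n) A                 ≈⟨ det-expand n A ⟩
    alternatingSum (laplaceTerm A)  ≈⟨ alternatingSum-cong (λ j → *-cong (A≈B zero j) (minor-cong j)) ⟩
    alternatingSum (laplaceTerm B)  ≈⟨ det-expand n B ⟨
    det R (suc n) B                 ∎
    where
    minor-cong : ∀ j → det R n (minor A j) ≈ det R n (minor B j)
    minor-cong j = det-cong n (λ x y → A≈B (suc x) (punchIn j y))

  det-linear-row : ∀ n (r : Fin n) {A B C : Matrix n} →
    (∀ x j → x ≢ r → A x j ≈ C x j) → (∀ x j → x ≢ r → B x j ≈ C x j) →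
    (∀ j → C r j ≈ A r j - B r j) → det R n C ≈ det R n A - det R n B
  det-linear-row (suc n) zero {A} {B} {C} A≈C B≈C C≈A-B = det-via-laplaceTerms A B C λ j → begin
    C zero j * det R n (minor C j)
      ≈⟨ *-congʳ (C≈A-B j) ⟩
    (A zero j - B zero j) * det R n (minor C j)
      ≈⟨ [y-z]x≈yx-zx _ (A zero j) (B zero j) ⟩
    A zero j * det R n (minor C j) - B zero j * det R n (minor C j)
      ≈⟨ +-cong (*-congˡ (minor≈ A≈C j)) (-‿cong (*-congˡ (minor≈ B≈C j))) ⟨
    laplaceTerm A j - laplaceTerm B j  ∎
    where
    minor≈ : ∀ {X} → (∀ x j → x ≢ zero → X x j ≈ C x j) → ∀ j → det R n (minor X j) ≈ det R n (minor C j)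
    minor≈ X≈C j = det-cong n (λ x y → X≈C (suc x) (punchIn j y) λ ())
  det-linear-row (suc n) (suc r) {A} {B} {C} A≈C B≈C C≈A-B = det-via-laplaceTerms A B C λ j → begin
    C zero j * det R n (minor C j)
      ≈⟨ *-congˡ (det-linear-row n r (minor≈ A≈C j) (minor≈ B≈C j) (C≈A-B ∘ punchIn j)) ⟩
    C zero j * (det R n (minor A j) - det R n (minor B j))
      ≈⟨ x[y-z]≈xy-xz (C zero j) _ _ ⟩
    C zero j * det R n (minor A j) - C zero j * det R n (minor B j)
      ≈⟨ +-cong (*-congʳ (A≈C zero j λ ())) (-‿cong (*-congʳ (B≈C zero j λ ()))) ⟨
    laplaceTerm A j - laplaceTerm B j  ∎
    where
    minor≈ : ∀ {X} → (∀ x j → x ≢ suc r → X x j ≈ C x j) → ∀ j x k → x ≢ r → minor X j x k ≈ minor C j x k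
    minor≈ X≈C j x k x≢r = X≈C (suc x) (punchIn j k) (x≢r ∘ suc-injective)

  -- Φ f stands for the determinant of the rows below the first two, restricted to the columns f.
  expand₂ : ∀ m → ((Fin m → Fin (suc (suc m))) → Carrier) → (a b : Fin (suc (suc m)) → Carrier) → Carrier
  expand₂ m Φ a b = alternatingSum λ j → a j * alternatingSum λ k → b (punchIn j k) * Φ (punchIn j ∘ punchIn k)

  det-expand₂ : ∀ m (B : Matrix (suc (suc m))) →
    det R (suc (suc m)) B ≈ expand₂ m (λ f → det R m (λ x y → B (suc (suc x)) (f y))) (B zero) (B (suc zero))
  det-expand₂ m B = trans (det-expand (suc m) B) (alternatingSum-cong λ j → *-congˡ {B zero j} (det-expand m (minor B j)))

  expandAvoiding₀ : ∀ m → ((Fin m → Fin (suc (suc m))) → Carrier) → (Fin (suc m) → Carrier) → Carrier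
  expandAvoiding₀ m Φ c = alternatingSum λ k → c k * Φ (suc ∘ punchIn k)

  expand₂Avoiding₀ : ∀ m → ((Fin m → Fin (suc (suc m))) → Carrier) → (a b : Fin (suc (suc m)) → Carrier) → Carrier
  expand₂Avoiding₀ m Φ a b =
    alternatingSum λ j → a (suc j) * alternatingSum λ k → b (suc (punchIn j k)) * Φ (punchIn (suc j) ∘ punchIn (suc k))

  -- The terms in which row a or row b takes column 0, and the rest.
  expand₂-split : ∀ m Φ a b → expand₂ m Φ a b ≈
    a zero * expandAvoiding₀ m Φ (b ∘ suc) + (expand₂Avoiding₀ m Φ a b - b zero * expandAvoiding₀ m Φ (a ∘ suc))
  expand₂-split m Φ a b = +-cong (*-identityˡ _) (begin
    ∑[ j < suc m ] ((- sgn (toℕ j)) * (a (suc j) * (1# * (b zero * X j) + ∑[ k < m ] ((- sgn (toℕ k)) * Y j k))))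
      ≈⟨ sum-cong-≋ {suc m} term ⟩
    ∑[ j < suc m ] (W j - b zero * V j)  ≈⟨ sum-distrib-- W (λ j → b zero * V j) ⟩
    sum W - ∑[ j < suc m ] (b zero * V j)  ≈⟨ +-congˡ (-‿cong (*-distribˡ-sum (b zero) V)) ⟨
    expand₂Avoiding₀ m Φ a b - b zero * expandAvoiding₀ m Φ (a ∘ suc)  ∎)
    where
    X : Fin (suc m) → Carrier
    X j = Φ (suc ∘ punchIn j)
    Y : Fin (suc m) → Fin m → Carrier
    Y j k = b (suc (punchIn j k)) * Φ (punchIn (suc j) ∘ punchIn (suc k))
    V W : Fin (suc m) → Carrier
    V j = sgn (toℕ j) * (a (suc j) * X j)
    W j = sgn (toℕ j) * (a (suc j) * alternatingSum (Y j))
    regroup : ∀ s x y u v → (- s) * (x * (y * u - v)) ≈ s * (x * v) - y * (s * (x * u))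
    regroup s x y u v = begin
      (- s) * (x * (y * u - v))                ≈⟨ -‿distribˡ-* s _ ⟨
      - (s * (x * (y * u - v)))                ≈⟨ -‿cong (trans (*-congˡ (x[y-z]≈xy-xz x _ _)) (x[y-z]≈xy-xz s _ _)) ⟩
      - (s * (x * (y * u)) - s * (x * v))      ≈⟨ ⁻¹-anti-homo‿- _ _ ⟩
      s * (x * v) - s * (x * (y * u))          ≈⟨ +-congˡ (-‿cong (solve 4 (λ s x y u → s ⊗ (x ⊗ (y ⊗ u)) , y ⊗ (s ⊗ (x ⊗ u))) refl s x y u)) ⟩
      s * (x * v) - y * (s * (x * u))          ∎
    term : ∀ j → (- sgn (toℕ j)) * (a (suc j) * (1# * (b zero * X j) + ∑[ k < m ] ((- sgn (toℕ k)) * Y j k))) ≈ W j - b zero * V j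
    term j = begin
      (- sgn (toℕ j)) * (a (suc j) * (1# * (b zero * X j) + ∑[ k < m ] ((- sgn (toℕ k)) * Y j k)))
        ≈⟨ *-congˡ (*-congˡ (+-cong (*-identityˡ (b zero * X j)) negated-signs)) ⟩
      (- sgn (toℕ j)) * (a (suc j) * (b zero * X j - alternatingSum (Y j)))
        ≈⟨ regroup (sgn (toℕ j)) (a (suc j)) (b zero) (X j) (alternatingSum (Y j)) ⟩
      W j - b zero * V j  ∎
      where
      negated-signs : ∑[ k < m ] ((- sgn (toℕ k)) * Y j k) ≈ - alternatingSum (Y j)
      negated-signs = trans (sum-cong-≋ {m} (λ k → sym (-‿distribˡ-* (sgn (toℕ k)) (Y j k))))
                            (sum-neg (λ k → sgn (toℕ k) * Y j k))

  expand₂Avoiding₀-zero : ∀ Φ a b → expand₂Avoiding₀ zero Φ a b ≈ 0#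
  expand₂Avoiding₀-zero Φ a b = trans (+-identityʳ (1# * (a (suc zero) * 0#))) (trans (*-congˡ (zeroʳ (a (suc zero)))) (zeroʳ 1#))

  expand₂Avoiding₀-suc : ∀ m Φ → Extensional R Φ → ∀ a b →
    expand₂Avoiding₀ (suc m) Φ a b ≈ expand₂ m (Φ ∘ Fin.lift 1) (a ∘ suc) (b ∘ suc)
  expand₂Avoiding₀-suc m Φ Φ-ext a b =
    alternatingSum-cong λ j → *-congˡ {a (suc j)} (alternatingSum-cong λ k → *-congˡ {b (suc (punchIn j k))}
      (Φ-ext (punchIn-suc-lift j k)))
    where
    punchIn-suc-lift : ∀ j k x → punchIn (suc j) (punchIn (suc k) x) ≡ Fin.lift 1 (punchIn j ∘ punchIn k) x
    punchIn-suc-lift j k zero    = ≡.refl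
    punchIn-suc-lift j k (suc x) = ≡.refl

  lift-extensional : ∀ {m k} {Φ : (Fin (suc m) → Fin (suc k)) → Carrier} → Extensional R Φ → Extensional R (Φ ∘ Fin.lift 1)
  lift-extensional Φ-ext f≗g = Φ-ext λ { zero → ≡.refl ; (suc x) → ≡.cong suc (f≗g x) }

  -- Induction on m: the column-0 terms cancel in pairs, and the rest is expand₂ one size smaller.
  expand₂-antisymmetric : ∀ m Φ → Extensional R Φ → ∀ a b → expand₂ m Φ a b + expand₂ m Φ b a ≈ 0#
  expand₂Avoiding₀-antisymmetric : ∀ m Φ → Extensional R Φ → ∀ a b →
    expand₂Avoiding₀ m Φ a b + expand₂Avoiding₀ m Φ b a ≈ 0#

  expand₂-antisymmetric m Φ Φ-ext a b = begin
    expand₂ m Φ a b + expand₂ m Φ b a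
      ≈⟨ +-cong (expand₂-split m Φ a b) (expand₂-split m Φ b a) ⟩
    (x + (expand₂Avoiding₀ m Φ a b - y)) + (y + (expand₂Avoiding₀ m Φ b a - x))
      ≈⟨ cancel x y _ _ ⟩
    expand₂Avoiding₀ m Φ a b + expand₂Avoiding₀ m Φ b a
      ≈⟨ expand₂Avoiding₀-antisymmetric m Φ Φ-ext a b ⟩
    0#  ∎
    where
    x y : Carrier
    x = a zero * expandAvoiding₀ m Φ (b ∘ suc)
    y = b zero * expandAvoiding₀ m Φ (a ∘ suc)
    cancel : ∀ x y w w′ → (x + (w - y)) + (y + (w′ - x)) ≈ w + w′
    cancel x y w w′ = begin
      (x + (w - y)) + (y + (w′ - x))
        ≈⟨ solve 6 (λ x -x y -y w w′ → (x ⊕ (w ⊕ -y)) ⊕ (y ⊕ (w′ ⊕ -x)) , (x ⊕ -x) ⊕ ((y ⊕ -y) ⊕ (w ⊕ w′)))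
                   refl x (- x) y (- y) w w′ ⟩
      (x - x) + ((y - y) + (w + w′))  ≈⟨ +-cong (-‿inverseʳ x) (+-congʳ (-‿inverseʳ y)) ⟩
      0# + (0# + (w + w′))            ≈⟨ trans (+-identityˡ _) (+-identityˡ _) ⟩
      w + w′                          ∎

  expand₂Avoiding₀-antisymmetric zero Φ _ a b =
    trans (+-cong (expand₂Avoiding₀-zero Φ a b) (expand₂Avoiding₀-zero Φ b a)) (+-identityʳ 0#)
  expand₂Avoiding₀-antisymmetric (suc m) Φ Φ-ext a b =
    trans (+-cong (expand₂Avoiding₀-suc m Φ Φ-ext a b) (expand₂Avoiding₀-suc m Φ Φ-ext b a))
          (expand₂-antisymmetric m (Φ ∘ Fin.lift 1) (lift-extensional Φ-ext) (a ∘ suc) (b ∘ suc))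

  det-swap₀₁ : ∀ m {B C : Matrix (suc (suc m))} → (∀ x j → C (suc (suc x)) j ≈ B (suc (suc x)) j) →
    (∀ j → C zero j ≈ B (suc zero) j) → (∀ j → C (suc zero) j ≈ B zero j) →
    det R (suc (suc m)) C ≈ - det R (suc (suc m)) B
  det-swap₀₁ m {B} {C} C≈B C₀≈B₁ C₁≈B₀ = begin
    det R (suc (suc m)) C                   ≈⟨ det-expand₂ m C ⟩
    expand₂ m ΦC (C zero) (C (suc zero))    ≈⟨ alternatingSum-cong (λ j → *-cong (C₀≈B₁ j) (alternatingSum-cong λ k →
                                                 *-cong (C₁≈B₀ (punchIn j k)) (ΦC≈ΦB (punchIn j ∘ punchIn k)))) ⟩
    expand₂ m ΦB (B (suc zero)) (B zero)    ≈⟨ inverseʳ-unique _ _ (expand₂-antisymmetric m ΦB ΦB-ext (B zero) (B (suc zero))) ⟩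
    - expand₂ m ΦB (B zero) (B (suc zero))  ≈⟨ -‿cong (det-expand₂ m B) ⟨
    - det R (suc (suc m)) B                 ∎
    where
    ΦB ΦC : (Fin m → Fin (suc (suc m))) → Carrier
    ΦB f = det R m (λ x y → B (suc (suc x)) (f y))
    ΦC f = det R m (λ x y → C (suc (suc x)) (f y))
    ΦC≈ΦB : ∀ f → ΦC f ≈ ΦB f
    ΦC≈ΦB f = det-cong m (λ x y → C≈B x (f y))
    ΦB-ext : Extensional R ΦB
    ΦB-ext f≗g = det-cong m (λ x y → reflexive (≡.cong (B (suc (suc x))) (f≗g y)))

  det-swap-adjacent : ∀ n (i : Fin n) {B C : Matrix (suc n)} →
    (∀ x j → x ≢ inject₁ i → x ≢ suc i → C x j ≈ B x j) →
    (∀ j → C (inject₁ i) j ≈ B (suc i) j) → (∀ j → C (suc i) j ≈ B (inject₁ i) j) →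
    det R (suc n) C ≈ - det R (suc n) B
  det-swap-adjacent (suc m) zero {B} {C} C≈B Cᵢ≈Bᵢ₊₁ Cᵢ₊₁≈Bᵢ =
    det-swap₀₁ m {B} {C} (λ x j → C≈B (suc (suc x)) j (λ ()) (λ ())) Cᵢ≈Bᵢ₊₁ Cᵢ₊₁≈Bᵢ
  det-swap-adjacent (suc m) (suc i) {B} {C} C≈B Cᵢ≈Bᵢ₊₁ Cᵢ₊₁≈Bᵢ = det-neg-via-laplaceTerms B C λ j → begin
    C zero j * det R (suc m) (minor C j)        ≈⟨ *-cong (C≈B zero j (λ ()) (λ ())) (det-swap-adjacent m i (minor≈ j)
                                                      (Cᵢ≈Bᵢ₊₁ ∘ punchIn j) (Cᵢ₊₁≈Bᵢ ∘ punchIn j)) ⟩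
    B zero j * - det R (suc m) (minor B j)      ≈⟨ -‿distribʳ-* (B zero j) _ ⟨
    - laplaceTerm B j                            ∎
    where
    minor≈ : ∀ j x k → x ≢ inject₁ i → x ≢ suc i → minor C j x k ≈ minor B j x k
    minor≈ j x k x≢i x≢i+1 = C≈B (suc x) (punchIn j k) (x≢i ∘ suc-injective) (x≢i+1 ∘ suc-injective)

module Pascal {c r : Level} (R : CommutativeRing c r) (h : ℕ → CommutativeRing.Carrier R) where
  open CommutativeRing R hiding (zero)
  open Sums R
  open import Data.Nat.Combinatorics using (_C_; nCk+nC[k+1]≡[n+1]C[k+1])
  open import Algebra.Properties.AbelianGroup +-abelianGroup using (xyx⁻¹≈y; ε⁻¹≈ε)
  open import Algebra.Properties.CommutativeSemigroup +-commutativeSemigroup using (x∙yz≈y∙xz)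
  open import Relation.Binary.Reasoning.Setoid setoid

  fromℕ-+ : ∀ m n → fromℕ R (m ℕ.+ n) ≈ fromℕ R m + fromℕ R n
  fromℕ-+ zero    n = sym (+-identityˡ _)
  fromℕ-+ (suc m) n = trans (+-congˡ (fromℕ-+ m n)) (sym (+-assoc _ _ _))

  kk-difference : ∀ ρ z → kk R h (suc ρ) z - kk R h (suc ρ) (z ℤ.- + 1) ≈ kk R h ρ z
  kk-difference ρ -[1+ _ ]  = -‿inverseʳ 0#
  kk-difference ρ (+ zero)  = trans (+-congˡ ε⁻¹≈ε) (+-identityʳ _)
  kk-difference ρ (+ suc m) = begin
    sumTo R (suc m) hi - sumTo R m hi′
      ≈⟨ +-cong (sumTo≈sum (suc m) hi) (-‿cong (sumTo≈sum m hi′)) ⟩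
    (hi 0 + ∑[ i < suc m ] hi (suc (toℕ i))) - ∑[ i < suc m ] hi′ (toℕ i)
      ≈⟨ +-congʳ (+-congˡ (trans (sum-cong-≋ {suc m} (pascal ∘ toℕ))
                                 (∑-distrib-+ {suc m} (hi′ ∘ toℕ) (lo ∘ suc ∘ toℕ)))) ⟩
    (hi 0 + (∑[ i < suc m ] hi′ (toℕ i) + ∑[ i < suc m ] lo (suc (toℕ i)))) - ∑[ i < suc m ] hi′ (toℕ i)
      ≈⟨ +-congʳ (x∙yz≈y∙xz _ _ _) ⟩
    (∑[ i < suc m ] hi′ (toℕ i) + (hi 0 + ∑[ i < suc m ] lo (suc (toℕ i)))) - ∑[ i < suc m ] hi′ (toℕ i)
      ≈⟨ xyx⁻¹≈y _ _ ⟩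
    ∑[ i < suc (suc m) ] lo (toℕ i)
      ≈⟨ sumTo≈sum (suc m) lo ⟨
    sumTo R (suc m) lo  ∎
    where
    binom : ℕ → ℕ → Carrier
    binom ρ i = fromℕ R ((ρ ℕ.+ i ∸ 1) C i)
    hi hi′ lo : ℕ → Carrier
    hi  i = binom (suc ρ) i * h (suc m ∸ i)
    hi′ i = binom (suc ρ) i * h (m ∸ i)
    lo  i = binom ρ i * h (suc m ∸ i)
    pascal : ∀ i → hi (suc i) ≈ hi′ i + lo (suc i)
    pascal i = begin
      fromℕ R ((ρ ℕ.+ suc i) C suc i) * h (m ∸ i)
        ≡⟨ ≡.cong (λ k → fromℕ R (k C suc i) * h (m ∸ i)) (ℕ.+-suc ρ i) ⟩
      fromℕ R (suc (ρ ℕ.+ i) C suc i) * h (m ∸ i)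
        ≡⟨ ≡.cong (λ k → fromℕ R k * h (m ∸ i)) (nCk+nC[k+1]≡[n+1]C[k+1] (ρ ℕ.+ i) i) ⟨
      fromℕ R (a ℕ.+ b) * h (m ∸ i)
        ≈⟨ trans (*-congʳ (fromℕ-+ a b)) (distribʳ (h (m ∸ i)) (fromℕ R a) (fromℕ R b)) ⟩
      hi′ i + fromℕ R b * h (m ∸ i)
        ≡⟨ ≡.cong (λ k → hi′ i + fromℕ R ((k ∸ 1) C suc i) * h (m ∸ i)) (ℕ.+-suc ρ i) ⟨
      hi′ i + lo (suc i)  ∎
      where
      a b : ℕ
      a = (ρ ℕ.+ i) C i
      b = (ρ ℕ.+ i) C suc i

weight : ∀ {a} {A : Set a} → (A → ℕ) → List A → ℕ
weight φ xs = ℕ.sum (map φ xs)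

module _ {a} {A : Set a} where
  open import Data.Nat using (_+_; _*_)

  weight-++ : ∀ (φ : A → ℕ) xs ys → weight φ (xs ++ ys) ≡ weight φ xs + weight φ ys
  weight-++ φ xs ys = ≡.trans (≡.cong ℕ.sum (map-++ φ xs ys)) (ℕ.sum-++ (map φ xs) (map φ ys))

  weight-cong : ∀ {φ ψ : A → ℕ} → (∀ x → φ x ≡ ψ x) → ∀ xs → weight φ xs ≡ weight ψ xs
  weight-cong φ≗ψ xs = ≡.cong ℕ.sum (map-cong φ≗ψ xs)

  weight-zero : ∀ {φ : A → ℕ} → (∀ x → φ x ≡ 0) → ∀ xs → weight φ xs ≡ 0
  weight-zero φ≗0 []       = ≡.refl
  weight-zero φ≗0 (x ∷ xs) = ≡.cong₂ _+_ (φ≗0 x) (weight-zero φ≗0 xs)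

  weight-map : ∀ {b} {B : Set b} (φ : A → ℕ) (f : B → A) xs → weight φ (map f xs) ≡ weight (φ ∘ f) xs
  weight-map φ f xs = ≡.cong ℕ.sum (≡.sym (map-∘ xs))

  weight-filterᵇ : ∀ (φ : A → ℕ) (P : A → Bool) xs → weight φ (filterᵇ P xs) ≡ weight (λ x → if P x then φ x else 0) xs
  weight-filterᵇ φ P []       = ≡.refl
  weight-filterᵇ φ P (x ∷ xs) with P x
  ... | true  = ≡.cong (_+_ (φ x)) (weight-filterᵇ φ P xs)
  ... | false = weight-filterᵇ φ P xs

  weight-concatMap : ∀ {b} {B : Set b} (φ : A → ℕ) (f : B → List A) xs → weight φ (concatMap f xs) ≡ weight (weight φ ∘ f) xs
  weight-concatMap φ f []       = ≡.refl
  weight-concatMap φ f (x ∷ xs) =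
    ≡.trans (weight-++ φ (f x) (concatMap f xs)) (≡.cong (_+_ (weight φ (f x))) (weight-concatMap φ f xs))

  weight-replicate : ∀ (φ : A → ℕ) n x → weight φ (replicate n x) ≡ n * φ x
  weight-replicate φ zero    x = ≡.refl
  weight-replicate φ (suc n) x = ≡.cong (_+_ (φ x)) (weight-replicate φ n x)

weight-allFin-suc : ∀ n (φ : Fin (suc n) → ℕ) → weight φ (allFin (suc n)) ≡ φ zero ℕ.+ weight (φ ∘ suc) (allFin n)
weight-allFin-suc n φ =
  ≡.cong (λ xs → φ zero ℕ.+ ℕ.sum xs) (≡.trans (map-tabulate suc φ) (≡.sym (map-tabulate (λ x → x) (φ ∘ suc))))

weight-allFin-single : ∀ n (φ : Fin n → ℕ) y → (∀ x → x ≢ y → φ x ≡ 0) → weight φ (allFin n) ≡ φ y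
weight-allFin-single (suc n) φ zero    φ≗0 = ≡.trans (weight-allFin-suc n φ)
  (≡.trans (≡.cong (ℕ._+_ (φ zero)) (weight-zero (λ x → φ≗0 (suc x) λ ()) (allFin n))) (ℕ.+-identityʳ (φ zero)))
weight-allFin-single (suc n) φ (suc y) φ≗0 = ≡.trans (weight-allFin-suc n φ)
  (≡.cong₂ ℕ._+_ (φ≗0 zero λ ()) (weight-allFin-single n (φ ∘ suc) y λ x x≢y → φ≗0 (suc x) (x≢y ∘ suc-injective)))

module Multiplicity {a} {A : Set a} (_≟_ : DecidableEquality A) where
  open import Data.Nat using (_+_)
  open import Algebra.Properties.CommutativeSemigroup ℕ.+-commutativeSemigroup using (x∙yz≈y∙xz)

  δ : A → A → ℕ
  δ z x = if does (z ≟ x) then 1 else 0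

  δ-refl : ∀ z → δ z z ≡ 1
  δ-refl z = ≡.cong (λ t → if t then 1 else 0) (dec-true (z ≟ z) ≡.refl)

  δ-≢ : ∀ {z x} → z ≢ x → δ z x ≡ 0
  δ-≢ {z} {x} z≢x = ≡.cong (λ t → if t then 1 else 0) (dec-false (z ≟ x) z≢x)

  multiplicity : A → List A → ℕ
  multiplicity z = weight (δ z)

  multiplicity≢0⇒∈ : ∀ z xs → multiplicity z xs ≢ 0 → z ∈ xs
  multiplicity≢0⇒∈ z []       m≢0 = contradiction ≡.refl m≢0
  multiplicity≢0⇒∈ z (x ∷ xs) m≢0 with z ≟ x
  ... | yes z≡x = here z≡x
  ... | no  _   = there (multiplicity≢0⇒∈ z xs m≢0)

  private
    head-occurs : ∀ {x xs ys} → (∀ z → multiplicity z (x ∷ xs) ≡ multiplicity z ys) → x ∈ ys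
    head-occurs {x} {xs} {ys} same = multiplicity≢0⇒∈ x ys λ m≡0 →
      ℕ.0≢1+n (≡.trans (≡.sym m≡0) (≡.trans (≡.sym (same x)) (≡.cong (_+ multiplicity x xs) (δ-refl x))))

  ↭-from-multiplicity : ∀ xs ys → (∀ z → multiplicity z xs ≡ multiplicity z ys) → xs ↭ ys
  ↭-from-multiplicity []       []       _    = ↭-refl
  ↭-from-multiplicity []       (y ∷ ys) same = contradiction (≡.trans (same y) (≡.cong (_+ multiplicity y ys) (δ-refl y))) ℕ.0≢1+n
  ↭-from-multiplicity (x ∷ xs) ys       same with ∈-∃++ (head-occurs {x} {xs} {ys} same)
  ... | us , vs , ≡.refl = ↭-trans (↭-prep x (↭-from-multiplicity xs (us ++ vs) same′)) (↭-sym (shift x us vs))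
    where
    same′ : ∀ z → multiplicity z xs ≡ multiplicity z (us ++ vs)
    same′ z = ℕ.+-cancelˡ-≡ (δ z x) _ _ (begin
      δ z x + multiplicity z xs                        ≡⟨ same z ⟩
      multiplicity z (us ++ x ∷ vs)                    ≡⟨ weight-++ (δ z) us (x ∷ vs) ⟩
      multiplicity z us + (δ z x + multiplicity z vs)  ≡⟨ x∙yz≈y∙xz (multiplicity z us) (δ z x) _ ⟩
      δ z x + (multiplicity z us + multiplicity z vs)  ≡⟨ ≡.cong (_+_ (δ z x)) (weight-++ (δ z) us vs) ⟨
      δ z x + multiplicity z (us ++ vs)                ∎)
      where open ≡.≡-Reasoning

  multiplicity-map-involution : ∀ (f : A → A) → (∀ x → f (f x) ≡ x) → ∀ z xs →
    multiplicity z (map f xs) ≡ multiplicity (f z) xs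
  multiplicity-map-involution f f-involutive z xs = ≡.trans (weight-map (δ z) f xs) (weight-cong δ-f xs)
    where
    δ-f : ∀ x → δ z (f x) ≡ δ (f z) x
    δ-f x = ≡.cong (λ t → if t then 1 else 0) (does-⇔ (mk⇔ (λ z≡fx → ≡.trans (≡.cong f z≡fx) (f-involutive x))
                                                          (λ fz≡x → ≡.trans (≡.sym (f-involutive z)) (≡.cong f fz≡x)))
                                                     (z ≟ f x) (f z ≟ x))

module FactorMultiplicity {c r : Level} (R : CommutativeRing c r) (h : ℕ → CommutativeRing.Carrier R) (ℓ : ℕ) where
  open import Data.Nat using (_+_; _*_)

  _≟ᶠ_ : DecidableEquality (Factor R h ℓ)
  root a b ≟ᶠ root a′ b′ with a ≟ a′ | b ≟ b′
  ... | yes ≡.refl | yes ≡.refl = yes ≡.refl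
  ... | no a≢a′    | _          = no λ { ≡.refl → a≢a′ ≡.refl }
  ... | yes _      | no b≢b′    = no λ { ≡.refl → b≢b′ ≡.refl }
  root _ _ ≟ᶠ down _ = no λ ()
  down _ ≟ᶠ root _ _ = no λ ()
  down b ≟ᶠ down b′ with b ≟ b′
  ... | yes ≡.refl = yes ≡.refl
  ... | no b≢b′    = no λ { ≡.refl → b≢b′ ≡.refl }

  open Multiplicity _≟ᶠ_ public

  private
    if-zero : ∀ (t : Bool) {n} → n ≡ 0 → (if t then n else 0) ≡ 0
    if-zero true  n≡0 = n≡0
    if-zero false _   = ≡.refl

    pairs : List (Fin ℓ × Fin ℓ)
    pairs = concatMap (λ a → map (a ,_) (allFin ℓ)) (allFin ℓ)

    -- factors Ψ M unfolds to roots Ψ ++ downs M.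
    roots : Pairs ℓ → List (Factor R h ℓ)
    roots Ψ = map (λ p → root (proj₁ p) (proj₂ p)) (filterᵇ (λ p → Ψ (proj₁ p) (proj₂ p)) pairs)

    downs : Multiset ℓ → List (Factor R h ℓ)
    downs M = concatMap (λ b → replicate (M b) (down b)) (allFin ℓ)

    multiplicity-roots : ∀ z Ψ → multiplicity z (roots Ψ) ≡
      weight (λ a → weight (λ b → if Ψ a b then δ z (root a b) else 0) (allFin ℓ)) (allFin ℓ)
    multiplicity-roots z Ψ = begin
      multiplicity z (roots Ψ)
        ≡⟨ weight-map (δ z) _ (filterᵇ inΨ pairs) ⟩
      weight (δ z ∘ rootOf) (filterᵇ inΨ pairs)
        ≡⟨ weight-filterᵇ (δ z ∘ rootOf) inΨ pairs ⟩
      weight φ pairs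
        ≡⟨ weight-concatMap φ (λ a → map (a ,_) (allFin ℓ)) (allFin ℓ) ⟩
      weight (λ a → weight φ (map (a ,_) (allFin ℓ))) (allFin ℓ)
        ≡⟨ weight-cong (λ a → weight-map φ (a ,_) (allFin ℓ)) (allFin ℓ) ⟩
      weight (λ a → weight (λ b → φ (a , b)) (allFin ℓ)) (allFin ℓ)  ∎
      where
      open ≡.≡-Reasoning
      rootOf : Fin ℓ × Fin ℓ → Factor R h ℓ
      rootOf p = root (proj₁ p) (proj₂ p)
      inΨ : Fin ℓ × Fin ℓ → Bool
      inΨ p = Ψ (proj₁ p) (proj₂ p)
      φ : Fin ℓ × Fin ℓ → ℕ
      φ p = if inΨ p then δ z (rootOf p) else 0

    multiplicity-downs : ∀ z M → multiplicity z (downs M) ≡ weight (λ b → M b * δ z (down b)) (allFin ℓ)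
    multiplicity-downs z M = ≡.trans (weight-concatMap (δ z) _ (allFin ℓ))
      (weight-cong (λ b → weight-replicate (δ z) (M b) (down b)) (allFin ℓ))

  multiplicity-root : ∀ (Ψ : Pairs ℓ) M a b → multiplicity (root a b) (factors R h Ψ M) ≡ (if Ψ a b then 1 else 0)
  multiplicity-root Ψ M a b = begin
    multiplicity (root a b) (factors R h Ψ M)
      ≡⟨ weight-++ (δ (root a b)) (roots Ψ) (downs M) ⟩
    multiplicity (root a b) (roots Ψ) + multiplicity (root a b) (downs M)
      ≡⟨ ≡.cong₂ _+_ (multiplicity-roots (root a b) Ψ) (multiplicity-downs (root a b) M) ⟩
    weight (λ a′ → weight (λ b′ → if Ψ a′ b′ then δ (root a b) (root a′ b′) else 0) (allFin ℓ)) (allFin ℓ)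
      + weight (λ b′ → M b′ * δ (root a b) (down b′)) (allFin ℓ)
      ≡⟨ ≡.cong₂ _+_ (weight-allFin-single ℓ _ a λ a′ a′≢a → weight-zero (λ b′ → if-zero (Ψ a′ b′)
                                                            (δ-≢ {root a b} {root a′ b′} λ { ≡.refl → a′≢a ≡.refl })) (allFin ℓ))
                     (weight-zero (λ b′ → ℕ.*-zeroʳ (M b′)) (allFin ℓ)) ⟩
    weight (λ b′ → if Ψ a b′ then δ (root a b) (root a b′) else 0) (allFin ℓ) + 0
      ≡⟨ ℕ.+-identityʳ _ ⟩
    weight (λ b′ → if Ψ a b′ then δ (root a b) (root a b′) else 0) (allFin ℓ)
      ≡⟨ weight-allFin-single ℓ _ b (λ b′ b′≢b →
           if-zero (Ψ a b′) (δ-≢ {root a b} {root a b′} λ { ≡.refl → b′≢b ≡.refl })) ⟩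
    (if Ψ a b then δ (root a b) (root a b) else 0)
      ≡⟨ ≡.cong (λ n → if Ψ a b then n else 0) (δ-refl (root a b)) ⟩
    (if Ψ a b then 1 else 0)  ∎
    where open ≡.≡-Reasoning

  multiplicity-down : ∀ (Ψ : Pairs ℓ) M b → multiplicity (down b) (factors R h Ψ M) ≡ M b
  multiplicity-down Ψ M b = begin
    multiplicity (down b) (factors R h Ψ M)
      ≡⟨ weight-++ (δ (down b)) (roots Ψ) (downs M) ⟩
    multiplicity (down b) (roots Ψ) + multiplicity (down b) (downs M)
      ≡⟨ ≡.cong₂ _+_ (multiplicity-roots (down b) Ψ) (multiplicity-downs (down b) M) ⟩
    weight (λ a′ → weight (λ b′ → if Ψ a′ b′ then δ (down b) (root a′ b′) else 0) (allFin ℓ)) (allFin ℓ)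
      + weight (λ b′ → M b′ * δ (down b) (down b′)) (allFin ℓ)
      ≡⟨ ≡.cong₂ _+_ (weight-zero (λ a′ → weight-zero (λ b′ → if-zero (Ψ a′ b′) ≡.refl) (allFin ℓ)) (allFin ℓ))
                     (weight-allFin-single ℓ _ b λ b′ b′≢b →
                        ≡.trans (≡.cong (M b′ *_) (δ-≢ {down b} {down b′} λ { ≡.refl → b′≢b ≡.refl })) (ℕ.*-zeroʳ (M b′))) ⟩
    0 + M b * δ (down b) (down b)
      ≡⟨ ≡.trans (≡.cong (M b *_) (δ-refl (down b))) (ℕ.*-identityʳ (M b)) ⟩
    M b  ∎
    where open ≡.≡-Reasoning

mapFactor : ∀ {c r : Level} (R : CommutativeRing c r) (h : ℕ → CommutativeRing.Carrier R) {ℓ : ℕ} →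
  (Fin ℓ → Fin ℓ) → Factor R h ℓ → Factor R h ℓ
mapFactor R h σ (root a b) = root (σ a) (σ b)
mapFactor R h σ (down b)   = down (σ b)

module RaisingOperators {c r : Level} (R : CommutativeRing c r) (h : ℕ → CommutativeRing.Carrier R) (N : ℕ) {ℓ : ℕ} where
  open CommutativeRing R hiding (zero; refl; trans)
  open CommutativeRing R using () renaming (refl to ≈-refl; trans to ≈-trans)
  open Sums R
  open import Algebra.Properties.AbelianGroup +-abelianGroup using (⁻¹-∙-comm)
  open import Tactic.RingSolver.NonReflective (fromCommutativeRing R (λ _ → nothing)) using (solve; _⊕_; ⊝_)

  raise : ℕ → Fin ℓ → Fin ℓ → (Fin ℓ → ℤ) → (Fin ℓ → ℤ)
  raise k a b γ x = (γ x ℤ.+ (+ k ℤ.* ε a x)) ℤ.- (+ k ℤ.* ε b x)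

  lower : Fin ℓ → (Fin ℓ → ℤ) → (Fin ℓ → ℤ)
  lower b γ x = γ x ℤ.- ε b x

  Operand : Set c
  Operand = (Fin ℓ → ℤ) → Carrier

  applyFactor : Factor R h ℓ → Operand → Operand
  applyFactor (root a b) F γ = ∑[ k < suc N ] F (raise (toℕ k) a b γ)
  applyFactor (down b)   F γ = F γ - F (lower b γ)

  applyFactors : List (Factor R h ℓ) → Operand → Operand
  applyFactors fs F = foldr applyFactor F fs

  G≈applyFactors : ∀ fs γ → G R h N fs γ ≈ applyFactors fs (g R h ℓ) γ
  G≈applyFactors []              γ = ≈-refl
  G≈applyFactors (root a b ∷ fs) γ =
    ≈-trans (sumTo≈sum N _) (sum-cong-≋ {suc N} λ k → G≈applyFactors fs (raise (toℕ k) a b γ))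
  G≈applyFactors (down b ∷ fs)   γ = +-cong (G≈applyFactors fs γ) (-‿cong (G≈applyFactors fs (lower b γ)))

  applyFactor-cong : ∀ x {F F′ : Operand} → (∀ γ → F γ ≈ F′ γ) → ∀ γ → applyFactor x F γ ≈ applyFactor x F′ γ
  applyFactor-cong (root a b) F≈F′ γ = sum-cong-≋ {suc N} λ k → F≈F′ (raise (toℕ k) a b γ)
  applyFactor-cong (down b)   F≈F′ γ = +-cong (F≈F′ γ) (-‿cong (F≈F′ (lower b γ)))

  applyFactor-extensional : ∀ x {F : Operand} → Extensional R F → Extensional R (applyFactor x F)
  applyFactor-extensional (root a b) F-ext γ≗δ =
    sum-cong-≋ {suc N} λ k → F-ext λ y →
      ≡.cong (λ t → (t ℤ.+ (+ toℕ k ℤ.* ε a y)) ℤ.- (+ toℕ k ℤ.* ε b y)) (γ≗δ y)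
  applyFactor-extensional (down b) F-ext γ≗δ =
    +-cong (F-ext γ≗δ) (-‿cong (F-ext λ y → ≡.cong (ℤ._- ε b y) (γ≗δ y)))

  applyFactor-root-down-comm : ∀ a b d {F : Operand} → Extensional R F → ∀ γ →
    applyFactor (root a b) (applyFactor (down d) F) γ ≈ applyFactor (down d) (applyFactor (root a b) F) γ
  applyFactor-root-down-comm a b d {F} F-ext γ =
    ≈-trans (sum-distrib-- {suc N} (λ k → F (raise (toℕ k) a b γ)) (λ k → F (lower d (raise (toℕ k) a b γ))))
    (+-congˡ (-‿cong (sum-cong-≋ {suc N} λ k → F-ext λ x →
      shifts-commute (γ x) (+ toℕ k ℤ.* ε a x) (+ toℕ k ℤ.* ε b x) (ε d x))))
    where
    shifts-commute : ∀ z u v e → ((z ℤ.+ u) ℤ.- v) ℤ.- e ≡ ((z ℤ.- e) ℤ.+ u) ℤ.- v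
    shifts-commute = ℤ-Solver.solve-∀

  applyFactor-comm : ∀ x y {F : Operand} → Extensional R F → ∀ γ →
    applyFactor x (applyFactor y F) γ ≈ applyFactor y (applyFactor x F) γ
  applyFactor-comm (root a b) (root c d) {F} F-ext γ =
    ≈-trans (∑-comm {suc N} {suc N} λ k l → F (raise (toℕ l) c d (raise (toℕ k) a b γ)))
    (sum-cong-≋ {suc N} λ l → sum-cong-≋ {suc N} λ k → F-ext λ x →
      ≡.sym (shifts-commute (γ x) (+ toℕ k ℤ.* ε a x) (+ toℕ k ℤ.* ε b x) (+ toℕ l ℤ.* ε c x) (+ toℕ l ℤ.* ε d x)))
    where
    shifts-commute : ∀ z u v u′ v′ → (((z ℤ.+ u′) ℤ.- v′) ℤ.+ u) ℤ.- v ≡ (((z ℤ.+ u) ℤ.- v) ℤ.+ u′) ℤ.- v′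
    shifts-commute = ℤ-Solver.solve-∀
  applyFactor-comm (root a b) (down d) F-ext γ = applyFactor-root-down-comm a b d F-ext γ
  applyFactor-comm (down d) (root a b) F-ext γ = sym (applyFactor-root-down-comm a b d F-ext γ)
  applyFactor-comm (down d) (down d′) {F} F-ext γ = ≈-trans (interchange (F γ) _ _ _)
    (+-congˡ (-‿cong (+-congˡ (-‿cong (F-ext λ x → lowers-commute (γ x) (ε d′ x) (ε d x))))))
    where
    interchange : ∀ s t u v → (s - t) - (u - v) ≈ (s - u) - (t - v)
    interchange = solve 4 (λ s t u v → ((s ⊕ (⊝ t)) ⊕ (⊝ (u ⊕ (⊝ v)))) , ((s ⊕ (⊝ u)) ⊕ (⊝ (t ⊕ (⊝ v))))) ≈-refl
    lowers-commute : ∀ z e e′ → (z ℤ.- e′) ℤ.- e ≡ (z ℤ.- e) ℤ.- e′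
    lowers-commute = ℤ-Solver.solve-∀

  applyFactors-cong : ∀ fs {F F′ : Operand} → (∀ γ → F γ ≈ F′ γ) → ∀ γ → applyFactors fs F γ ≈ applyFactors fs F′ γ
  applyFactors-cong []       F≈F′ = F≈F′
  applyFactors-cong (x ∷ fs) F≈F′ = applyFactor-cong x (applyFactors-cong fs F≈F′)

  applyFactors-extensional : ∀ fs {F : Operand} → Extensional R F → Extensional R (applyFactors fs F)
  applyFactors-extensional []       F-ext = F-ext
  applyFactors-extensional (x ∷ fs) F-ext = applyFactor-extensional x (applyFactors-extensional fs F-ext)

  applyFactors-↭ : ∀ {fs fs′} → fs ↭ fs′ → ∀ {F : Operand} → Extensional R F → ∀ γ →
    applyFactors fs F γ ≈ applyFactors fs′ F γ
  applyFactors-↭ ↭.refl                 F-ext γ = ≈-refl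
  applyFactors-↭ (↭.prep x p)           F-ext γ = applyFactor-cong x (applyFactors-↭ p F-ext) γ
  applyFactors-↭ (↭.swap {xs} x y p) {F} F-ext γ =
    ≈-trans (applyFactor-comm x y (applyFactors-extensional xs F-ext) γ)
            (applyFactor-cong y (applyFactor-cong x (applyFactors-↭ p F-ext)) γ)
  applyFactors-↭ (↭.trans p q)          F-ext γ = ≈-trans (applyFactors-↭ p F-ext γ) (applyFactors-↭ q F-ext γ)

  applyFactors-neg : ∀ fs (F : Operand) γ → applyFactors fs (λ δ → - F δ) γ ≈ - applyFactors fs F γ
  applyFactors-neg []                F γ = ≈-refl
  applyFactors-neg (root a b ∷ fs)   F γ =
    ≈-trans (sum-cong-≋ {suc N} λ k → applyFactors-neg fs F (raise (toℕ k) a b γ))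
            (sum-neg {suc N} λ k → applyFactors fs F (raise (toℕ k) a b γ))
  applyFactors-neg (down b ∷ fs)     F γ =
    ≈-trans (+-cong (applyFactors-neg fs F γ) (-‿cong (applyFactors-neg fs F (lower b γ)))) (⁻¹-∙-comm _ _)

module Conjugation {c r : Level} (R : CommutativeRing c r) (h : ℕ → CommutativeRing.Carrier R) (N : ℕ) {ℓ : ℕ}
  (σ : Fin ℓ → Fin ℓ) (σ-injective : ∀ {x y} → σ x ≡ σ y → x ≡ y) (u w : Fin ℓ → ℤ) where
  open CommutativeRing R hiding (zero; refl; trans)
  open CommutativeRing R using () renaming (refl to ≈-refl; trans to ≈-trans)
  open Sums R
  open RaisingOperators R h N

  τ : (Fin ℓ → ℤ) → (Fin ℓ → ℤ)
  τ γ x = (γ (σ x) ℤ.- u x) ℤ.+ w x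

  σFactor : Factor R h ℓ → Factor R h ℓ
  σFactor = mapFactor R h σ

  ε-σ : ∀ a x → ε (σ a) (σ x) ≡ ε a x
  ε-σ a x = ≡.cong (λ t → if t then + 1 else + 0) (does-⇔ (mk⇔ σ-injective (≡.cong σ)) (σ x ≟ σ a) (x ≟ a))

  ∘τ-extensional : ∀ {F : Operand} → Extensional R F → Extensional R (F ∘ τ)
  ∘τ-extensional F-ext γ≗δ = F-ext λ x → ≡.cong (λ t → (t ℤ.- u x) ℤ.+ w x) (γ≗δ (σ x))

  applyFactor-τ : ∀ x {F : Operand} → Extensional R F → ∀ γ → applyFactor x F (τ γ) ≈ applyFactor (σFactor x) (F ∘ τ) γ
  applyFactor-τ (root a b) F-ext γ = sum-cong-≋ {suc N} λ k → F-ext λ x → ≡.trans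
    (shifts-commute (γ (σ x)) (u x) (w x) (+ toℕ k ℤ.* ε a x) (+ toℕ k ℤ.* ε b x))
    (≡.cong₂ (λ s t → (((γ (σ x) ℤ.+ (+ toℕ k ℤ.* s)) ℤ.- (+ toℕ k ℤ.* t)) ℤ.- u x) ℤ.+ w x)
             (≡.sym (ε-σ a x)) (≡.sym (ε-σ b x)))
    where
    shifts-commute : ∀ z u w s t → (((z ℤ.- u) ℤ.+ w) ℤ.+ s) ℤ.- t ≡ (((z ℤ.+ s) ℤ.- t) ℤ.- u) ℤ.+ w
    shifts-commute = ℤ-Solver.solve-∀
  applyFactor-τ (down b) F-ext γ = +-congˡ (-‿cong (F-ext λ x → ≡.trans
    (shifts-commute (γ (σ x)) (u x) (w x) (ε b x))
    (≡.cong (λ t → ((γ (σ x) ℤ.- t) ℤ.- u x) ℤ.+ w x) (≡.sym (ε-σ b x)))))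
    where
    shifts-commute : ∀ z u w e → ((z ℤ.- u) ℤ.+ w) ℤ.- e ≡ ((z ℤ.- e) ℤ.- u) ℤ.+ w
    shifts-commute = ℤ-Solver.solve-∀

  applyFactors-τ : ∀ fs {F : Operand} → Extensional R F → ∀ γ →
    applyFactors fs F (τ γ) ≈ applyFactors (map σFactor fs) (F ∘ τ) γ
  applyFactors-τ []       F-ext γ = ≈-refl
  applyFactors-τ (x ∷ fs) F-ext γ = ≈-trans (applyFactor-τ x (applyFactors-extensional fs F-ext) γ)
    (applyFactor-cong (σFactor x) (applyFactors-τ fs F-ext) γ)

ε-≡ : ∀ {ℓ} (a : Fin ℓ) → ε a a ≡ + 1
ε-≡ a = ≡.cong (λ t → if t then + 1 else + 0) (dec-true (a ≟ a) ≡.refl)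

ε-≢ : ∀ {ℓ} {a x : Fin ℓ} → x ≢ a → ε a x ≡ + 0
ε-≢ {a = a} {x} x≢a = ≡.cong (λ t → if t then + 1 else + 0) (dec-false (x ≟ a) x≢a)

module AdjacentTransposition {n : ℕ} (i : Fin n) where

  -- In the 0-based indexing of Defs, p and q are the paper's i and i+1.

  p q : Fin (suc n)
  p = inject₁ i
  q = suc i

  σ : Fin (suc n) → Fin (suc n)
  σ = swapᵢ i

  p≢q : p ≢ q
  p≢q = <⇒≢ (≤̄⇒inject₁< ≤-refl)

  σ-p : σ p ≡ q
  σ-p = ≡.cong (λ t → if t then q else (if does (p ≟ q) then p else p)) (dec-true (p ≟ p) ≡.refl)

  σ-q : σ q ≡ p
  σ-q with q ≟ p
  ... | yes q≡p = contradiction (≡.sym q≡p) p≢q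
  ... | no  _   = ≡.cong (λ t → if t then p else q) (dec-true (q ≟ q) ≡.refl)

  σ-other : ∀ x → x ≢ p → x ≢ q → σ x ≡ x
  σ-other x x≢p x≢q with x ≟ p
  ... | yes x≡p = contradiction x≡p x≢p
  ... | no  _   = ≡.cong (λ t → if t then p else x) (dec-false (x ≟ q) x≢q)

  data Position (x : Fin (suc n)) : Set where
    at-p  : x ≡ p → Position x
    at-q  : x ≡ q → Position x
    other : x ≢ p → x ≢ q → Position x

  position : ∀ x → Position x
  position x with x ≟ p | x ≟ q
  ... | yes x≡p | _       = at-p x≡p
  ... | no  _   | yes x≡q = at-q x≡q
  ... | no  x≢p | no  x≢q = other x≢p x≢q

  σ-involutive : ∀ x → σ (σ x) ≡ x
  σ-involutive x with position x
  ... | at-p ≡.refl     = ≡.trans (≡.cong σ σ-p) σ-q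
  ... | at-q ≡.refl     = ≡.trans (≡.cong σ σ-q) σ-p
  ... | other x≢p x≢q   = ≡.trans (≡.cong σ (σ-other x x≢p x≢q)) (σ-other x x≢p x≢q)

  σ-injective : ∀ {x y} → σ x ≡ σ y → x ≡ y
  σ-injective {x} {y} σx≡σy = ≡.trans (≡.sym (σ-involutive x)) (≡.trans (≡.cong σ σx≡σy) (σ-involutive y))

  private
    sγ-at : ∀ γ {x y e e′} → σ x ≡ y → ε p x ≡ e → ε q x ≡ e′ → sγ i γ x ≡ (γ y ℤ.- e) ℤ.+ e′
    sγ-at γ σx≡y εp≡e εq≡e′ = ≡.cong₂ ℤ._+_ (≡.cong₂ (λ y e → γ y ℤ.- e) σx≡y εp≡e) εq≡e′

  sγ-p : ∀ γ → sγ i γ p ≡ γ q ℤ.- + 1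
  sγ-p γ = ≡.trans (sγ-at γ {p} σ-p (ε-≡ p) (ε-≢ p≢q)) (ℤ.+-identityʳ _)

  sγ-q : ∀ γ → sγ i γ q ≡ γ p ℤ.+ + 1
  sγ-q γ = ≡.trans (sγ-at γ {q} σ-q (ε-≢ (p≢q ∘′ ≡.sym)) (ε-≡ q)) (≡.cong (ℤ._+ + 1) (ℤ.+-identityʳ (γ p)))

  sγ-other : ∀ γ x → x ≢ p → x ≢ q → sγ i γ x ≡ γ x
  sγ-other γ x x≢p x≢q =
    ≡.trans (sγ-at γ {x} (σ-other x x≢p x≢q) (ε-≢ x≢p) (ε-≢ x≢q)) (≡.trans (ℤ.+-identityʳ _) (ℤ.+-identityʳ _))

module LoweredRow {c r : Level} (R : CommutativeRing c r) (h : ℕ → CommutativeRing.Carrier R) {n : ℕ} (i : Fin n) where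
  open CommutativeRing R hiding (zero)
  open Determinant R
  open Pascal R h
  open AdjacentTransposition i
  open import Relation.Binary.Reasoning.Setoid setoid

  gMatrix : (Fin (suc n) → ℤ) → Matrix (suc n)
  gMatrix γ x j = kk R h (toℕ x) ((γ x ℤ.+ + toℕ j) ℤ.- + toℕ x)

  level : Fin (suc n) → ℕ
  level x = if does (x ≟ q) then toℕ i else toℕ x

  loweredMatrix : (Fin (suc n) → ℤ) → Matrix (suc n)
  loweredMatrix γ x j = kk R h (level x) ((γ x ℤ.+ + toℕ j) ℤ.- + toℕ x)

  level-q : level q ≡ toℕ i
  level-q = ≡.cong (λ t → if t then toℕ i else toℕ q) (dec-true (q ≟ q) ≡.refl)

  level-other : ∀ {x} → x ≢ q → level x ≡ toℕ x
  level-other {x} x≢q = ≡.cong (λ t → if t then toℕ i else toℕ x) (dec-false (x ≟ q) x≢q)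

  level-p : level p ≡ toℕ i
  level-p = ≡.trans (level-other p≢q) (toℕ-inject₁ i)

  kk-cong : ∀ {ρ ρ′ z z′} → ρ ≡ ρ′ → z ≡ z′ → kk R h ρ z ≈ kk R h ρ′ z′
  kk-cong ρ≡ρ′ z≡z′ = reflexive (≡.cong₂ (kk R h) ρ≡ρ′ z≡z′)

  kk-cong-level : ∀ {ρ ρ′} z → ρ ≡ ρ′ → kk R h ρ z ≈ kk R h ρ′ z
  kk-cong-level z ρ≡ρ′ = kk-cong ρ≡ρ′ (≡.refl {x = z})

  g′ : (Fin (suc n) → ℤ) → Carrier
  g′ γ = g R h (suc n) γ - g R h (suc n) (λ x → γ x ℤ.- ε q x)

  g′≈det-lowered : ∀ γ → g′ γ ≈ det R (suc n) (loweredMatrix γ)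
  g′≈det-lowered γ = sym (det-linear-row (suc n) q upper lower row-q)
    where
    upper : ∀ x j → x ≢ q → gMatrix γ x j ≈ loweredMatrix γ x j
    upper x j x≢q = kk-cong-level ((γ x ℤ.+ + toℕ j) ℤ.- + toℕ x) (≡.sym (level-other x≢q))
    lower : ∀ x j → x ≢ q → gMatrix (λ y → γ y ℤ.- ε q y) x j ≈ loweredMatrix γ x j
    lower x j x≢q = kk-cong (≡.sym (level-other x≢q))
      (≡.cong (λ t → (t ℤ.+ + toℕ j) ℤ.- + toℕ x)
              (≡.trans (≡.cong (λ e → γ x ℤ.- e) (ε-≢ x≢q)) (ℤ.+-identityʳ (γ x))))
    lower-index : ∀ z j t → ((z ℤ.- + 1) ℤ.+ j) ℤ.- t ≡ ((z ℤ.+ j) ℤ.- t) ℤ.- + 1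
    lower-index = ℤ-Solver.solve-∀
    row-q : ∀ j → loweredMatrix γ q j ≈ gMatrix γ q j - gMatrix (λ y → γ y ℤ.- ε q y) q j
    row-q j = begin
      loweredMatrix γ q j                       ≈⟨ kk-cong-level z level-q ⟩
      kk R h (toℕ i) z                          ≈⟨ kk-difference (toℕ i) z ⟨
      kk R h (toℕ q) z - kk R h (toℕ q) (z ℤ.- + 1)
        ≈⟨ +-congˡ (-‿cong (kk-cong ≡.refl (≡.trans (≡.cong (λ e → ((γ q ℤ.- e) ℤ.+ + toℕ j) ℤ.- + toℕ q) (ε-≡ q))
                                                      (lower-index (γ q) (+ toℕ j) (+ toℕ q))))) ⟨
      gMatrix γ q j - gMatrix (λ y → γ y ℤ.- ε q y) q j  ∎
      where
      z : ℤ
      z = (γ q ℤ.+ + toℕ j) ℤ.- + toℕ q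

  det-lowered-swap : ∀ γ → det R (suc n) (loweredMatrix (sγ i γ)) ≈ - det R (suc n) (loweredMatrix γ)
  det-lowered-swap γ = det-swap-adjacent n i others row-p row-q
    where
    others : ∀ x j → x ≢ p → x ≢ q → loweredMatrix (sγ i γ) x j ≈ loweredMatrix γ x j
    others x j x≢p x≢q = kk-cong ≡.refl (≡.cong (λ t → (t ℤ.+ + toℕ j) ℤ.- + toℕ x) (sγ-other γ x x≢p x≢q))
    lower-p : ∀ z j t → ((z ℤ.- + 1) ℤ.+ j) ℤ.- t ≡ (z ℤ.+ j) ℤ.- (+ 1 ℤ.+ t)
    lower-p = ℤ-Solver.solve-∀
    raise-q : ∀ z j t → ((z ℤ.+ + 1) ℤ.+ j) ℤ.- (+ 1 ℤ.+ t) ≡ (z ℤ.+ j) ℤ.- t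
    raise-q = ℤ-Solver.solve-∀
    toℕ-p : + toℕ p ≡ + toℕ i
    toℕ-p = ≡.cong +_ (toℕ-inject₁ i)
    row-p : ∀ j → loweredMatrix (sγ i γ) p j ≈ loweredMatrix γ q j
    row-p j = kk-cong (≡.trans level-p (≡.sym level-q))
      (≡.trans (≡.cong₂ (λ s t → (s ℤ.+ + toℕ j) ℤ.- t) (sγ-p γ) toℕ-p) (lower-p (γ q) (+ toℕ j) (+ toℕ i)))
    row-q : ∀ j → loweredMatrix (sγ i γ) q j ≈ loweredMatrix γ p j
    row-q j = kk-cong (≡.trans level-q (≡.sym level-p))
      (≡.trans (≡.cong (λ s → (s ℤ.+ + toℕ j) ℤ.- + toℕ q) (sγ-q γ))
               (≡.trans (raise-q (γ p) (+ toℕ j) (+ toℕ i)) (≡.cong (λ t → (γ p ℤ.+ + toℕ j) ℤ.- t) (≡.sym toℕ-p))))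

  g′-antisymmetric : ∀ γ → g′ (sγ i γ) ≈ - g′ γ
  g′-antisymmetric γ = begin
    g′ (sγ i γ)                                   ≈⟨ g′≈det-lowered (sγ i γ) ⟩
    det R (suc n) (loweredMatrix (sγ i γ))        ≈⟨ det-lowered-swap γ ⟩
    - det R (suc n) (loweredMatrix γ)             ≈⟨ -‿cong (g′≈det-lowered γ) ⟨
    - g′ γ                                        ∎

module SymmetricFactors {c r : Level} (R : CommutativeRing c r) (h : ℕ → CommutativeRing.Carrier R) {n : ℕ} (i : Fin n) where
  open AdjacentTransposition i
  open FactorMultiplicity R h (suc n)
  open import Data.Nat using (_+_)

  -- M with one copy of i+1 removed, when M (i+1) = 1 + M i.
  removeOne : Multiset (suc n) → Multiset (suc n)
  removeOne M b = if does (b ≟ q) then M p else M b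

  removeOne-q : ∀ M → removeOne M q ≡ M p
  removeOne-q M = ≡.cong (λ t → if t then M p else M q) (dec-true (q ≟ q) ≡.refl)

  removeOne-other : ∀ M {b} → b ≢ q → removeOne M b ≡ M b
  removeOne-other M {b} b≢q = ≡.cong (λ t → if t then M p else M b) (dec-false (b ≟ q) b≢q)

  removeOne-σ : ∀ M b → removeOne M (σ b) ≡ removeOne M b
  removeOne-σ M b with position b
  ... | at-p ≡.refl   = ≡.trans (≡.cong (removeOne M) σ-p) (≡.trans (removeOne-q M) (≡.sym (removeOne-other M p≢q)))
  ... | at-q ≡.refl   = ≡.trans (≡.cong (removeOne M) σ-q) (≡.trans (removeOne-other M p≢q) (≡.sym (removeOne-q M)))
  ... | other b≢p b≢q = ≡.cong (removeOne M) (σ-other b b≢p b≢q)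

  factors-removeOne : ∀ Ψ M → M q ≡ suc (M p) → factors R h Ψ M ↭ factors R h Ψ (removeOne M) ++ [ down q ]
  factors-removeOne Ψ M Mq≡1+Mp = ↭-from-multiplicity _ _ λ z →
    ≡.trans (counts z) (≡.sym (weight-++ (δ z) (factors R h Ψ (removeOne M)) [ down q ]))
    where
    counts : ∀ z → multiplicity z (factors R h Ψ M) ≡ multiplicity z (factors R h Ψ (removeOne M)) + (δ z (down q) + 0)
    counts (root a b) = ≡.trans (multiplicity-root Ψ M a b)
      (≡.sym (≡.trans (ℕ.+-identityʳ _) (multiplicity-root Ψ (removeOne M) a b)))
    counts (down b) with b ≟ q
    ... | yes ≡.refl = ≡.trans (multiplicity-down Ψ M q) (≡.trans Mq≡1+Mp (≡.sym (≡.trans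
      (≡.cong (_+ 1) (≡.trans (multiplicity-down Ψ (removeOne M) q) (removeOne-q M))) (ℕ.+-comm (M p) 1))))
    ... | no b≢q = ≡.trans (multiplicity-down Ψ M b) (≡.sym (≡.trans (ℕ.+-identityʳ _)
      (≡.trans (multiplicity-down Ψ (removeOne M) b) (removeOne-other M b≢q))))

  mapFactor-σ-involutive : ∀ x → mapFactor R h σ (mapFactor R h σ x) ≡ x
  mapFactor-σ-involutive (root a b) = ≡.cong₂ root (σ-involutive a) (σ-involutive b)
  mapFactor-σ-involutive (down b)   = ≡.cong down (σ-involutive b)

  factors-σ-invariant : ∀ Ψ M → (∀ a b → sΨ i Ψ a b ≡ Ψ a b) →
    map (mapFactor R h σ) (factors R h Ψ (removeOne M)) ↭ factors R h Ψ (removeOne M)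
  factors-σ-invariant Ψ M sΨ≡Ψ = ↭-from-multiplicity _ _ λ z →
    ≡.trans (multiplicity-map-involution (mapFactor R h σ) mapFactor-σ-involutive z (factors R h Ψ (removeOne M))) (counts z)
    where
    counts : ∀ z → multiplicity (mapFactor R h σ z) (factors R h Ψ (removeOne M)) ≡ multiplicity z (factors R h Ψ (removeOne M))
    counts (root a b) = ≡.trans (multiplicity-root Ψ _ (σ a) (σ b))
      (≡.trans (≡.cong (λ t → if t then 1 else 0) (sΨ≡Ψ a b)) (≡.sym (multiplicity-root Ψ _ a b)))
    counts (down b) = ≡.trans (multiplicity-down Ψ _ (σ b)) (≡.trans (removeOne-σ M b) (≡.sym (multiplicity-down Ψ _ b)))

module Antisymmetry {c r : Level} (R : CommutativeRing c r) (h : ℕ → CommutativeRing.Carrier R) (N : ℕ) {n : ℕ} (i : Fin n) where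
  open CommutativeRing R hiding (zero)
  open Determinant R using (det-cong)
  open AdjacentTransposition i
  open RaisingOperators R h N
  -- With these parameters τ is definitionally sγ i.
  open Conjugation R h N σ σ-injective (ε p) (ε q)
  open LoweredRow R h i using (g′; g′-antisymmetric)
  open SymmetricFactors R h i
  open import Relation.Binary.Reasoning.Setoid setoid

  g-extensional : Extensional R (g R h (suc n))
  g-extensional γ≗δ =
    det-cong (suc n) λ x j → reflexive (≡.cong (λ t → kk R h (toℕ x) ((t ℤ.+ + toℕ j) ℤ.- + toℕ x)) (γ≗δ x))

  Kₜ≈ : ∀ Ψ M → M q ≡ suc (M p) → ∀ γ → Kₜ R h N Ψ M γ ≈ applyFactors (factors R h Ψ (removeOne M)) g′ γ
  Kₜ≈ Ψ M Mq≡1+Mp γ = begin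
    Kₜ R h N Ψ M γ
      ≈⟨ G≈applyFactors (factors R h Ψ M) γ ⟩
    applyFactors (factors R h Ψ M) (g R h (suc n)) γ
      ≈⟨ applyFactors-↭ (factors-removeOne Ψ M Mq≡1+Mp) g-extensional γ ⟩
    applyFactors (L ++ [ down q ]) (g R h (suc n)) γ
      ≡⟨ ≡.cong (λ F → F γ) (foldr-++ applyFactor (g R h (suc n)) L [ down q ]) ⟩
    applyFactors L g′ γ  ∎
    where
    L : List (Factor R h (suc n))
    L = factors R h Ψ (removeOne M)

  Kₜ-antisymmetric : ∀ Ψ M → (∀ a b → sΨ i Ψ a b ≡ Ψ a b) → M q ≡ suc (M p) → ∀ γ →
    Kₜ R h N Ψ M γ + Kₜ R h N Ψ M (sγ i γ) ≈ 0#
  Kₜ-antisymmetric Ψ M sΨ≡Ψ Mq≡1+Mp γ = begin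
    Kₜ R h N Ψ M γ + Kₜ R h N Ψ M (τ γ)            ≈⟨ +-cong (Kₜ≈ Ψ M Mq≡1+Mp γ) (Kₜ≈ Ψ M Mq≡1+Mp (τ γ)) ⟩
    applyFactors L g′ γ + applyFactors L g′ (τ γ)  ≈⟨ +-congˡ conjugate ⟩
    applyFactors L g′ γ - applyFactors L g′ γ      ≈⟨ -‿inverseʳ _ ⟩
    0#                                             ∎
    where
    L : List (Factor R h (suc n))
    L = factors R h Ψ (removeOne M)
    g′-extensional : Extensional R g′
    g′-extensional = applyFactor-extensional (down q) g-extensional
    conjugate : applyFactors L g′ (τ γ) ≈ - applyFactors L g′ γ
    conjugate = begin
      applyFactors L g′ (τ γ)
        ≈⟨ applyFactors-τ L g′-extensional γ ⟩
      applyFactors (map σFactor L) (g′ ∘ τ) γ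
        ≈⟨ applyFactors-↭ (factors-σ-invariant Ψ M sΨ≡Ψ) (∘τ-extensional g′-extensional) γ ⟩
      applyFactors L (g′ ∘ τ) γ
        ≈⟨ applyFactors-cong L g′-antisymmetric γ ⟩
      applyFactors L (λ δ → - g′ δ) γ
        ≈⟨ applyFactors-neg L g′ γ ⟩
      - applyFactors L g′ γ  ∎

-- The identity holds at every truncation level, so N₀ = 0.
lemma3p3 : ∀ {c r : Level} (R : CommutativeRing c r)
           (h : ℕ → CommutativeRing.Carrier R) →
           CommutativeRing._≈_ R (h 0) (CommutativeRing.1# R) →
           (n : ℕ) (Ψ : Pairs (suc n)) (M : Multiset (suc n)) (i : Fin n) →
           IsRootIdeal Ψ →
           (∀ a b → sΨ i Ψ a b ≡ Ψ a b) →
           M (suc i) ≡ suc (M (inject₁ i)) →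
           (γ : Fin (suc n) → ℤ) →
           ∃ λ N₀ → ∀ N → N₀ ≤ N →
             CommutativeRing._≈_ R
               (CommutativeRing._+_ R (Kₜ R h N Ψ M γ) (Kₜ R h N Ψ M (sγ i γ)))
               (CommutativeRing.0# R)
lemma3p3 R h _ n Ψ M i _ sΨ≡Ψ Mq≡1+Mp γ = 0 , λ N _ → Antisymmetry.Kₜ-antisymmetric R h N i Ψ M sΨ≡Ψ Mq≡1+Mp γ
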